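{- Let $D_0$ be a diagram, $(r,c)\in D_0$, and let $D_0\succ D_1\succ\cdots\succ D_n$ be a Kohnert chain $\Gamma$ in $\mathcal{P}(D_0)$. Let $\mathrm{R}_\Gamma(D_0,r,c)$ be the set of rows $s$ such that, for some $j\in[n]$, $D_j$ is obtained from $D_{j-1}$ by the Kohnert move at row $s$ and this move moves the standard $r$-cell in column $c$ of $D_{j-1}$ (that cell being $(s,c)$). Then $|\mathrm{R}_\Gamma(D_0,r,c)|\le\mathrm{room}_{D_0}(r,c)$.
   Context: A diagram is a finite subset $D\subset\mathbb{Z}_{>0}\times\mathbb{Z}_{>0}$; $(r,c)\in D$ is a cell in row $r$, column $c$. Kohnert move at row $r$: if row $r$ is empty, $\mathcal{K}(D,r)=D$; otherwise let $(r,c)$ be the rightmost cell of row $r$; if some $r'<r$ has $(r',c)\notin D$, take the largest such $r'$ and set $\mathcal{K}(D,r)=(D\setminus\{(r,c)\})\cup\{(r',c)\}$; else $\mathcal{K}(D,r)=D$. $\mathcal{P}(D_0)$ is the set of diagrams obtainable from $D_0$ by finite sequences of Kohnert moves, ordered by $D_2\preceq D_1$ iff $D_2$ is obtainable from $D_1$ by Kohnert moves. A Kohnert chain $D_0\succ D_1\succ\cdots\succ D_n$ is a sequence with $D_j=\mathcal{K}(D_{j-1},s_j)\ne D_{j-1}$ for some row $s_j$, for each $j\in[n]$. Kohnert moves preserve the number of cells in each column. For $D\in\mathcal{P}(D_0)$ and $(r,c)\in D_0$, if $(r,c)$ is the $k$-th lowest cell of column $c$ in $D_0$, the standard $r$-cell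 in column $c$ of $D$ is the $k$-th lowest cell of column $c$ in $D$. For a diagram $D$, $(r,c)\in D$, $\tilde c>0$: $\mathrm{blockers}_{D,\tilde c}(r,c)=\{(\tilde r,\tilde c)\in D:\tilde r\le r\}$ and $\mathrm{room}_D(r,c)=r-\max_{\tilde c\ge c}|\mathrm{blockers}_{D,\tilde c}(r,c)|$. -}

module Defs where

open import Data.Nat using (ℕ; zero; suc; _+_; _∸_; _⊔_; _≤_; _<_)
import Data.Nat.Properties as ℕP
open import Data.Product using (_×_; _,_; Σ; proj₁; proj₂)
open import Data.Product.Properties using (≡-dec)
open import Data.Sum using (_⊎_)
open import Data.List using (List; []; _∷_; length; filter; map; foldr; upTo)
open import Data.List.Relation.Unary.All using (All)
open import Relation.Binary.PropositionalEquality using (_≡_; _≢_)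
open import Relation.Nullary using (¬_)
open import Function.Bundles using (_⇔_)

-- A cell (row , column); rows and columns are 1-indexed (positive).
Cell : Set
Cell = ℕ × ℕ

-- A diagram is a finite set of cells, represented by a list read as a set
-- (only membership matters; duplicates/order irrelevant).
Diagram : Set
Diagram = List Cell

open import Data.List.Membership.DecPropositional (≡-dec ℕP._≟_ ℕP._≟_)
  public using (_∈_; _∉_; _∈?_)

ValidDiagram : Diagram → Set
ValidDiagram D = All (λ x → 1 ≤ proj₁ x × 1 ≤ proj₂ x) D

Rightmost : Diagram → ℕ → ℕ → Set
Rightmost D s c = ((s , c) ∈ D) × (∀ c' → (s , c') ∈ D → c' ≤ c)

KohnertStep : Diagram → ℕ → ℕ → Diagram → Set
KohnertStep D s c D' =
  Rightmost D s c ×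
  Σ ℕ (λ r' →
    (1 ≤ r') × (r' < s) × ((r' , c) ∉ D) ×
    (∀ r'' → r' < r'' → r'' < s → (r'' , c) ∈ D) ×
    (∀ x → (x ∈ D') ⇔ (((x ∈ D) × (x ≢ (s , c))) ⊎ (x ≡ (r' , c)))))

KohnertMove : Diagram → ℕ → Diagram → Set
KohnertMove D s D' = Σ ℕ (λ c → KohnertStep D s c D')

countBlockers : Diagram → ℕ → ℕ → ℕ
countBlockers D r c̃ = length (filter (λ r̃ → (r̃ , c̃) ∈? D) (upTo (suc r)))

maxCol : Diagram → ℕ
maxCol D = foldr (λ x m → proj₂ x ⊔ m) 0 D

-- max_{c̃ ≥ c} |blockers_{D,c̃}(r,c)|; columns c̃ > maxCol D contribute 0,
-- so it suffices to range over c̃ ∈ {c, …, c + maxCol D}.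
maxBlockers : Diagram → ℕ → ℕ → ℕ
maxBlockers D r c = foldr _⊔_ 0 (map (λ k → countBlockers D r (c + k)) (upTo (suc (maxCol D))))

room : Diagram → ℕ → ℕ → ℕ
room D r c = r ∸ maxBlockers D r c

-- (s , c) is the standard r-cell in column c of D (relative to D0):
-- if (r , c) is the k-th lowest cell of column c of D0, then (s , c) is
-- the k-th lowest cell of column c of D.
StandardCell : Diagram → ℕ → ℕ → Diagram → ℕ → Set
StandardCell D0 r c D s =
  ((s , c) ∈ D) × (countBlockers D s c ≡ countBlockers D0 r c)

KohnertChain : (n : ℕ) → (ℕ → Diagram) → (ℕ → ℕ) → Set
KohnertChain n D rows = ∀ j → j < n → KohnertMove (D j) (rows j) (D (suc j))

InR : (n : ℕ) → (ℕ → Diagram) → (ℕ → ℕ) → ℕ → ℕ → ℕ → Set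
InR n D rows r c s =
  Σ ℕ (λ j → (j < n) × (s ≡ rows j) ×
    KohnertStep (D j) s c (D (suc j)) × StandardCell (D 0) r c (D j) s)

{-# OPTIONS --safe #-}
-- Fix a column c̃ ≥ c and follow the standard r-cell, i.e. the k-th lowest cell of column c
-- with k = |blockers_{D₀,c}(r,c)|; say it lies in row σ of D_j.  The potential
-- σ − |blockers_{D_j,c̃}(σ,c)| never increases: cells only move down, and if another cell of
-- column c jumps over the standard cell, the standard cell becomes the one a row lower while at
-- most one blocker is lost.  If the standard cell itself moves, every row strictly between its
-- source and its target is occupied in column c, so the standard cell of the next diagram is
-- exactly one row lower; being rightmost in its row it had no blocker in row σ of a column c̃ > c,
-- so the potential drops by one.  With no cells in row 0 the potential stays nonnegative, hence
-- the standard cell moves at most r − |blockers_{D₀,c̃}(r,c)| times, for every c̃ ≥ c.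
module Submission where

open import Defs
open import Data.Nat using (ℕ; zero; suc; _+_; _∸_; _⊔_; _≤_; _<_; z≤n; s≤s; z<s; _≟_; _≤?_)
open import Data.Nat.Properties
open import Algebra.Properties.CommutativeSemigroup +-commutativeSemigroup using (interchange)
open import Data.Product using (_×_; _,_; Σ; proj₁; proj₂)
open import Data.Sum using (_⊎_; inj₁; inj₂)
open import Data.List using (List; []; _∷_; length; filter; map; upTo; _++_)
open import Data.List.Properties
  using (filter-++; filter-all; filter-accept; filter-reject; length-++; length-map; upTo-∷ʳ; foldr-preservesᵇ)
open import Data.List.Relation.Unary.All as All using (All; []; _∷_)
open import Data.List.Relation.Unary.All.Properties using (all-filter; filter⁺; map⁺)
open import Data.List.Relation.Unary.AllPairs using ([]; _∷_)
open import Data.List.Relation.Unary.Unique.Propositional using (Unique)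
import Data.List.Relation.Unary.Unique.Propositional.Properties as Unique
open import Relation.Nullary using (¬_; Dec; yes; no; ¬?; _×-dec_; contradiction)
open import Relation.Binary.PropositionalEquality
open import Data.Nat.Tactic.RingSolver using (solve-∀)
open import Function using (_∘_)
open import Function.Bundles using (Equivalence)

indicator : {A : Set} → Dec A → ℕ
indicator (yes _) = 1
indicator (no _) = 0

indicator-yes : {A : Set} (a? : Dec A) → A → indicator a? ≡ 1
indicator-yes (yes _) _ = refl
indicator-yes (no ¬a) a = contradiction a ¬a

indicator-no : {A : Set} (a? : Dec A) → ¬ A → indicator a? ≡ 0
indicator-no (yes a) ¬a = contradiction a ¬a
indicator-no (no _) _ = refl

indicator-≤1 : {A : Set} (a? : Dec A) → indicator a? ≤ 1
indicator-≤1 (yes _) = ≤-refl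
indicator-≤1 (no _) = z≤n

indicator-mono : {A B : Set} (a? : Dec A) (b? : Dec B) → (A → B) → indicator a? ≤ indicator b?
indicator-mono (yes a) b? f = ≤-reflexive (sym (indicator-yes b? (f a)))
indicator-mono (no _) _ _ = z≤n

indicator-cong : {A B : Set} (a? : Dec A) (b? : Dec B) → (A → B) → (B → A) →
                 indicator a? ≡ indicator b?
indicator-cong a? b? f g = ≤-antisym (indicator-mono a? b? f) (indicator-mono b? a? g)

prefixSum : (ℕ → ℕ) → ℕ → ℕ
prefixSum f zero = f 0
prefixSum f (suc t) = prefixSum f t + f (suc t)

prefixSum-cong : ∀ {f g} → (∀ x → f x ≡ g x) → ∀ t → prefixSum f t ≡ prefixSum g t
prefixSum-cong f≗g zero = f≗g 0
prefixSum-cong f≗g (suc t) = cong₂ _+_ (prefixSum-cong f≗g t) (f≗g (suc t))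

prefixSum-+ : ∀ f g t → prefixSum (λ x → f x + g x) t ≡ prefixSum f t + prefixSum g t
prefixSum-+ f g zero = refl
prefixSum-+ f g (suc t) = begin
  prefixSum (λ x → f x + g x) t + (f (suc t) + g (suc t))
    ≡⟨ cong (_+ (f (suc t) + g (suc t))) (prefixSum-+ f g t) ⟩
  (prefixSum f t + prefixSum g t) + (f (suc t) + g (suc t))
    ≡⟨ interchange (prefixSum f t) (prefixSum g t) (f (suc t)) (g (suc t)) ⟩
  (prefixSum f t + f (suc t)) + (prefixSum g t + g (suc t)) ∎
  where open ≡-Reasoning

prefixSum-monoʳ : ∀ f {a t} → a ≤ t → prefixSum f a ≤ prefixSum f t
prefixSum-monoʳ f {t = zero} z≤n = ≤-refl
prefixSum-monoʳ f {t = suc t} a≤1+t with m≤n⇒m<n∨m≡n a≤1+t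
... | inj₂ refl = ≤-refl
... | inj₁ (s≤s a≤t) = ≤-trans (prefixSum-monoʳ f a≤t) (m≤m+n _ _)

prefixSum-point : ∀ a t → prefixSum (λ x → indicator (x ≟ a)) t ≡ indicator (a ≤? t)
prefixSum-point a zero = indicator-cong (0 ≟ a) (a ≤? 0) (λ { refl → z≤n }) (λ { z≤n → refl })
prefixSum-point a (suc t) rewrite prefixSum-point a t with a ≤? t
... | yes a≤t = trans (cong suc (indicator-no (suc t ≟ a) (λ { refl → <-irrefl refl a≤t })))
                   (sym (indicator-yes (a ≤? suc t) (m≤n⇒m≤1+n a≤t)))
... | no a≰t = indicator-cong (suc t ≟ a) (a ≤? suc t) (λ { refl → ≤-refl })
                 (λ a≤1+t → ≤-antisym (≰⇒> a≰t) a≤1+t)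

length-filter-upTo : ∀ {P : ℕ → Set} (P? : ∀ x → Dec (P x)) t →
                     length (filter P? (upTo (suc t))) ≡ prefixSum (λ x → indicator (P? x)) t
length-filter-upTo P? zero with P? 0
... | yes _ = refl
... | no _ = refl
length-filter-upTo P? (suc t) = begin
  length (filter P? (upTo (suc (suc t))))
    ≡⟨ cong (λ xs → length (filter P? xs)) (sym (upTo-∷ʳ (suc t))) ⟩
  length (filter P? (upTo (suc t) ++ suc t ∷ []))
    ≡⟨ cong length (filter-++ P? (upTo (suc t)) (suc t ∷ [])) ⟩
  length (filter P? (upTo (suc t)) ++ filter P? (suc t ∷ []))
    ≡⟨ length-++ (filter P? (upTo (suc t))) ⟩
  length (filter P? (upTo (suc t))) + length (filter P? (suc t ∷ []))
    ≡⟨ cong₂ _+_ (length-filter-upTo P? t) (length-filter-singleton (suc t)) ⟩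
  prefixSum (λ x → indicator (P? x)) t + indicator (P? (suc t)) ∎
  where
  open ≡-Reasoning
  length-filter-singleton : ∀ x → length (filter P? (x ∷ [])) ≡ indicator (P? x)
  length-filter-singleton x with P? x
  ... | yes _ = refl
  ... | no _ = refl

count : Diagram → ℕ → ℕ → ℕ
count E t c = prefixSum (λ x → indicator ((x , c) ∈? E)) t

countBlockers≡count : ∀ E t c → countBlockers E t c ≡ count E t c
countBlockers≡count E t c = length-filter-upTo (λ x → (x , c) ∈? E) t

NoCellInRowZero : Diagram → Set
NoCellInRowZero E = ∀ c → (0 , c) ∉ E

valid⇒noCellInRowZero : ∀ {E} → ValidDiagram E → NoCellInRowZero E
valid⇒noCellInRowZero valid c 0∈E with All.lookup valid 0∈E
... | () , _

count-≤ : ∀ E {c} → NoCellInRowZero E → ∀ t → count E t c ≤ t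
count-≤ E {c} noRow0 zero = ≤-reflexive (indicator-no ((0 , c) ∈? E) (noRow0 c))
count-≤ E {c} noRow0 (suc t) = begin
  count E t c + indicator ((suc t , c) ∈? E) ≤⟨ +-mono-≤ (count-≤ E noRow0 t) (indicator-≤1 _) ⟩
  t + 1                                     ≡⟨ +-comm t 1 ⟩
  suc t                                     ∎
  where open ≤-Reasoning

count-< : ∀ E {c a b} → a < b → (b , c) ∈ E → count E a c < count E b c
count-< E {c} {a} {suc b} (s≤s a≤b) b∈E = begin-strict
  count E a c                                <⟨ m<m+n _ z<s ⟩
  count E a c + 1                            ≤⟨ +-mono-≤ (prefixSum-monoʳ _ a≤b)
                                                         (≤-reflexive (sym (indicator-yes _ b∈E))) ⟩
  count E b c + indicator ((suc b , c) ∈? E) ∎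
  where open ≤-Reasoning

count-injective : ∀ E {c a b} → (a , c) ∈ E → (b , c) ∈ E → count E a c ≡ count E b c → a ≡ b
count-injective E a∈E b∈E eq = ≤-antisym
  (≮⇒≥ λ b<a → <-irrefl (sym eq) (count-< E b<a a∈E))
  (≮⇒≥ λ a<b → <-irrefl eq (count-< E a<b b∈E))

rightmost-unique : ∀ {E s c c'} → Rightmost E s c → Rightmost E s c' → c ≡ c'
rightmost-unique (c∈E , ≤c) (c'∈E , ≤c') = ≤-antisym (≤c' _ c∈E) (≤c _ c'∈E)

rightmost-∉ : ∀ {E s c c'} → Rightmost E s c → c < c' → (s , c') ∉ E
rightmost-∉ (_ , ≤c) c<c' c'∈E = <⇒≱ c<c' (≤c _ c'∈E)

module KohnertStepProperties {E E' : Diagram} {s c : ℕ} (step : KohnertStep E s c E') where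

  rightmost : Rightmost E s c
  rightmost = proj₁ step

  target : ℕ
  target = proj₁ (proj₂ step)

  1≤target : 1 ≤ target
  1≤target = let (_ , _ , 1≤t , _) = step in 1≤t

  target<s : target < s
  target<s = let (_ , _ , _ , t<s , _) = step in t<s

  target∉E : (target , c) ∉ E
  target∉E = let (_ , _ , _ , _ , t∉E , _) = step in t∉E

  between∈E : ∀ x → target < x → x < s → (x , c) ∈ E
  between∈E = let (_ , _ , _ , _ , _ , b∈E , _) = step in b∈E

  private
    E'-members : ∀ x → x ∈ E' → ((x ∈ E) × (x ≢ (s , c))) ⊎ (x ≡ (target , c))
    E'-members x = let (_ , _ , _ , _ , _ , _ , E'⇔) = step in Equivalence.to (E'⇔ x)

    E'-members⁻ : ∀ x → ((x ∈ E) × (x ≢ (s , c))) ⊎ (x ≡ (target , c)) → x ∈ E'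
    E'-members⁻ x = let (_ , _ , _ , _ , _ , _ , E'⇔) = step in Equivalence.from (E'⇔ x)

  ∈-kept : ∀ {x} → x ∈ E → x ≢ (s , c) → x ∈ E'
  ∈-kept x∈E x≢s = E'-members⁻ _ (inj₁ (x∈E , x≢s))

  target∈E' : (target , c) ∈ E'
  target∈E' = E'-members⁻ _ (inj₂ refl)

  ∈-kept⁻ : ∀ {x} → x ∈ E' → x ≢ (target , c) → x ∈ E
  ∈-kept⁻ x∈E' x≢target with E'-members _ x∈E'
  ... | inj₁ (x∈E , _) = x∈E
  ... | inj₂ x≡target = contradiction x≡target x≢target

  source∉E' : (s , c) ∉ E'
  source∉E' s∈E' with E'-members _ s∈E'
  ... | inj₁ (_ , s≢s) = s≢s refl
  ... | inj₂ s≡target = <-irrefl (cong proj₁ (sym s≡target)) target<s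

  noCellInRowZero : NoCellInRowZero E → NoCellInRowZero E'
  noCellInRowZero noRow0 c' 0∈E' with E'-members _ 0∈E'
  ... | inj₁ (0∈E , _) = noRow0 c' 0∈E
  ... | inj₂ 0≡target = <-irrefl (cong proj₁ 0≡target) 1≤target

  count-other-column : ∀ {c'} → c' ≢ c → ∀ t → count E' t c' ≡ count E t c'
  count-other-column c'≢c = prefixSum-cong λ x →
    indicator-cong (_ ∈? E') (_ ∈? E) (λ x∈E' → ∈-kept⁻ x∈E' (c'≢c ∘ cong proj₂))
                                      (λ x∈E → ∈-kept x∈E (c'≢c ∘ cong proj₂))

  count-moved-column : ∀ t → count E' t c + indicator (s ≤? t) ≡ count E t c + indicator (target ≤? t)
  count-moved-column t = begin
    count E' t c + indicator (s ≤? t)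
      ≡⟨ cong (count E' t c +_) (sym (prefixSum-point s t)) ⟩
    count E' t c + prefixSum (point s) t
      ≡⟨ sym (prefixSum-+ (occupied E') (point s) t) ⟩
    prefixSum (λ x → occupied E' x + point s x) t
      ≡⟨ prefixSum-cong occupancy-moves t ⟩
    prefixSum (λ x → occupied E x + point target x) t
      ≡⟨ prefixSum-+ (occupied E) (point target) t ⟩
    count E t c + prefixSum (point target) t
      ≡⟨ cong (count E t c +_) (prefixSum-point target t) ⟩
    count E t c + indicator (target ≤? t) ∎
    where
    open ≡-Reasoning
    occupied : Diagram → ℕ → ℕ
    occupied F x = indicator ((x , c) ∈? F)
    point : ℕ → ℕ → ℕ
    point a x = indicator (x ≟ a)
    occupancy-moves : ∀ x → occupied E' x + point s x ≡ occupied E x + point target x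
    occupancy-moves x with x ≟ s
    ... | yes refl = begin
      occupied E' s + 1 ≡⟨ cong (_+ 1) (indicator-no (_ ∈? E') source∉E') ⟩
      1                 ≡⟨ cong₂ _+_ (sym (indicator-yes (_ ∈? E) (proj₁ rightmost)))
                                     (sym (indicator-no (s ≟ target) λ s≡t → <-irrefl (sym s≡t) target<s)) ⟩
      occupied E s + point target s ∎
    ... | no x≢s with x ≟ target
    ...   | yes refl = trans (cong (_+ 0) (indicator-yes (_ ∈? E') target∈E'))
                             (cong (_+ 1) (sym (indicator-no (_ ∈? E) target∉E)))
    ...   | no x≢target = cong (_+ 0) (indicator-cong (_ ∈? E') (_ ∈? E)
            (λ x∈E' → ∈-kept⁻ x∈E' (x≢target ∘ cong proj₁))
            (λ x∈E → ∈-kept x∈E (x≢s ∘ cong proj₁)))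

  private
    count-moved-column-at : ∀ {t a b} → indicator (s ≤? t) ≡ a → indicator (target ≤? t) ≡ b →
                            count E' t c + a ≡ count E t c + b
    count-moved-column-at {t} s≤t≡a target≤t≡b =
      trans (cong (count E' t c +_) (sym s≤t≡a))
            (trans (count-moved-column t) (cong (count E t c +_) target≤t≡b))

  count-outside : ∀ t → t < target ⊎ s ≤ t → count E' t c ≡ count E t c
  count-outside t (inj₁ t<target) = +-cancelʳ-≡ 0 _ _ (count-moved-column-at
    (indicator-no _ (<⇒≱ (<-trans t<target target<s))) (indicator-no _ (<⇒≱ t<target)))
  count-outside t (inj₂ s≤t) = +-cancelʳ-≡ 1 _ _ (count-moved-column-at
    (indicator-yes _ s≤t) (indicator-yes _ (≤-trans (<⇒≤ target<s) s≤t)))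

  count-between : ∀ t → target ≤ t → t < s → count E' t c ≡ suc (count E t c)
  count-between t target≤t t<s = trans (sym (+-identityʳ _))
    (trans (count-moved-column-at (indicator-no _ (<⇒≱ t<s)) (indicator-yes _ target≤t)) (+-comm _ 1))

  count-mono : ∀ c' t → count E t c' ≤ count E' t c'
  count-mono c' t with c' ≟ c | target ≤? t | s ≤? t
  ... | no c'≢c | _ | _ = ≤-reflexive (sym (count-other-column c'≢c t))
  ... | yes refl | yes target≤t | no s≰t = ≤-trans (n≤1+n _) (≤-reflexive (sym (count-between t target≤t (≰⇒> s≰t))))
  ... | yes refl | no target≰t | _ = ≤-reflexive (sym (count-outside t (inj₁ (≰⇒> target≰t))))
  ... | yes refl | _ | yes s≤t = ≤-reflexive (sym (count-outside t (inj₂ s≤t)))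

chain-noCellInRowZero : ∀ {n D rows} → KohnertChain n D rows → NoCellInRowZero (D 0) →
                        ∀ j → j ≤ n → NoCellInRowZero (D j)
chain-noCellInRowZero chain noRow0 zero _ = noRow0
chain-noCellInRowZero chain noRow0 (suc j) j<n =
  KohnertStepProperties.noCellInRowZero (proj₂ (chain j j<n)) (chain-noCellInRowZero chain noRow0 j (<⇒≤ j<n))

module KthCellOfColumn (c k : ℕ) where

  Kth : Diagram → ℕ → Set
  Kth E σ = ((σ , c) ∈ E) × (count E σ c ≡ k)

  -- The potential σ ∸ count E σ c̃ of the k-th cell drops by at least e from E to E',
  -- stated additively to avoid truncated subtraction.
  PotentialDrop : ℕ → ℕ → Diagram → ℕ → Diagram → Set
  PotentialDrop e c̃ E σ E' = Σ ℕ λ σ' → Kth E' σ' × count E σ c̃ + (e + σ') ≤ count E' σ' c̃ + σ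

  kth-unique : ∀ {E σ σ'} → Kth E σ → Kth E σ' → σ ≡ σ'
  kth-unique (σ∈E , σ-kth) (σ'∈E , σ'-kth) = count-injective _ σ∈E σ'∈E (trans σ-kth (sym σ'-kth))

  kth-other-column : ∀ {E E' s c₀ σ} → KohnertStep E s c₀ E' → c₀ ≢ c → Kth E σ → Kth E' σ
  kth-other-column {σ = σ} step c₀≢c (σ∈E , kth) =
    ∈-kept σ∈E (c₀≢c ∘ sym ∘ cong proj₂) , trans (count-other-column (c₀≢c ∘ sym) σ) kth
    where open KohnertStepProperties step

  module _ {E E' : Diagram} {s : ℕ} (step : KohnertStep E s c E') where
    open KohnertStepProperties step

    kth-outside : ∀ {σ} → σ ≢ s → σ < target ⊎ s ≤ σ → Kth E σ → Kth E' σ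
    kth-outside {σ} σ≢s σ-outside (σ∈E , kth) =
      ∈-kept σ∈E (σ≢s ∘ cong proj₁) , trans (count-outside σ σ-outside) kth

    kth-shifts-down : ∀ {σ} → target ≤ σ → σ < s → Kth E (suc σ) → Kth E' σ
    kth-shifts-down {σ} target≤σ σ<s (1+σ∈E , kth) = σ∈E' , (begin
      count E' σ c                               ≡⟨ count-between σ target≤σ σ<s ⟩
      suc (count E σ c)                          ≡⟨ +-comm 1 _ ⟩
      count E σ c + 1                            ≡⟨ cong (count E σ c +_) (sym (indicator-yes _ 1+σ∈E)) ⟩
      count E σ c + indicator ((suc σ , c) ∈? E) ≡⟨ kth ⟩
      k                                          ∎)
      where
      open ≡-Reasoning
      σ∈E' : (σ , c) ∈ E'
      σ∈E' with m≤n⇒m<n∨m≡n target≤σ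
      ... | inj₁ target<σ = ∈-kept (between∈E σ target<σ σ<s) (λ σ≡s → <-irrefl (cong proj₁ σ≡s) σ<s)
      ... | inj₂ refl = target∈E'

    kth-shifts-down-potential : ∀ {c̃ σ} → target < σ → σ ≤ s → Kth E σ → PotentialDrop 0 c̃ E σ E'
    kth-shifts-down-potential {σ = zero} () _ _
    kth-shifts-down-potential {c̃} {suc σ} (s≤s target≤σ) σ<s kth =
      σ , kth-shifts-down target≤σ σ<s kth , (begin
        (count E σ c̃ + indicator ((suc σ , c̃) ∈? E)) + σ
          ≤⟨ +-monoˡ-≤ σ (+-mono-≤ (count-mono c̃ σ) (indicator-≤1 _)) ⟩
        (count E' σ c̃ + 1) + σ ≡⟨ +-assoc _ 1 σ ⟩
        count E' σ c̃ + suc σ   ∎)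
      where open ≤-Reasoning

    kth-not-moved-in-column : ∀ {c̃ σ} → Kth E σ → σ ≢ s → PotentialDrop 0 c̃ E σ E'
    kth-not-moved-in-column {c̃} {σ} kth σ≢s with s ≤? σ | σ <? target
    ... | yes s≤σ | _ = σ , kth-outside σ≢s (inj₂ s≤σ) kth , +-monoˡ-≤ σ (count-mono c̃ σ)
    ... | no _ | yes σ<target = σ , kth-outside σ≢s (inj₁ σ<target) kth , +-monoˡ-≤ σ (count-mono c̃ σ)
    ... | no s≰σ | no σ≮target =
      kth-shifts-down-potential (≤∧≢⇒< (≮⇒≥ σ≮target) target≢σ) (<⇒≤ (≰⇒> s≰σ)) kth
      where
      target≢σ : target ≢ σ
      target≢σ refl = target∉E (proj₁ kth)

  kth-moved : ∀ {c̃ E E' s} → c ≤ c̃ → KohnertStep E s c E' → Kth E s → PotentialDrop 1 c̃ E s E'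
  kth-moved {s = zero} _ step _ = contradiction (KohnertStepProperties.target<s step) n≮0
  kth-moved {c̃} {E} {E'} {suc σ} c≤c̃ step kth = σ , kth' , +-monoˡ-≤ (suc σ) blockers-kept
    where
    open KohnertStepProperties step
    kth' : Kth E' σ
    kth' = kth-shifts-down step (≤-pred target<s) ≤-refl kth
    blockers-kept : count E (suc σ) c̃ ≤ count E' σ c̃
    blockers-kept with c̃ ≟ c
    ... | yes refl = ≤-reflexive (trans (proj₂ kth) (sym (proj₂ kth')))
    ... | no c̃≢c = ≤-reflexive (begin
      count E σ c̃ + indicator ((suc σ , c̃) ∈? E)
        ≡⟨ cong (count E σ c̃ +_) (indicator-no _ (rightmost-∉ rightmost (≤∧≢⇒< c≤c̃ (c̃≢c ∘ sym)))) ⟩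
      count E σ c̃ + 0 ≡⟨ +-identityʳ _ ⟩
      count E σ c̃     ≡⟨ sym (count-other-column c̃≢c σ) ⟩
      count E' σ c̃    ∎)
      where open ≡-Reasoning

  kth-not-moved : ∀ {c̃ E E' s c₀ σ} → KohnertStep E s c₀ E' → Kth E σ → ¬ (c₀ ≡ c × σ ≡ s) →
                  PotentialDrop 0 c̃ E σ E'
  kth-not-moved {c̃} {c₀ = c₀} {σ} step kth not-moved with c₀ ≟ c
  ... | no c₀≢c = σ , kth-other-column step c₀≢c kth ,
                  +-monoˡ-≤ σ (KohnertStepProperties.count-mono step c̃ σ)
  ... | yes refl = kth-not-moved-in-column step kth (λ σ≡s → not-moved (refl , σ≡s))

length-≤-suc-filter-≢ : ∀ j {T : List ℕ} → Unique T → length T ≤ suc (length (filter (λ i → ¬? (i ≟ j)) T))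
length-≤-suc-filter-≢ j [] = z≤n
length-≤-suc-filter-≢ j {i ∷ T} (i∉T ∷ uniq) with i ≟ j
... | yes refl = ≤-reflexive (cong (suc ∘ length) (sym (begin
      filter ≢i? (i ∷ T) ≡⟨ filter-reject ≢i? (λ i≢i → i≢i refl) ⟩
      filter ≢i? T       ≡⟨ filter-all ≢i? (All.map (λ i≢x x≡i → i≢x (sym x≡i)) i∉T) ⟩
      T                  ∎)))
  where
  open ≡-Reasoning
  ≢i? : ∀ x → Dec (x ≢ i)
  ≢i? x = ¬? (x ≟ i)
... | no i≢j = ≤-trans (s≤s (length-≤-suc-filter-≢ j uniq))
                       (≤-reflexive (cong (suc ∘ length) (sym (filter-accept (λ x → ¬? (x ≟ j)) i≢j))))

all-preimages : ∀ {A B : Set} {f : A → B} {P : A → Set} {ys : List B} →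
                All (λ y → Σ A λ x → f x ≡ y × P x) ys → Σ (List A) λ xs → map f xs ≡ ys × All P xs
all-preimages [] = [] , refl , []
all-preimages {f = f} ((x , refl , px) ∷ preimages) =
  let (xs , map-f-xs≡ys , pxs) = all-preimages preimages in x ∷ xs , cong (f x ∷_) map-f-xs≡ys , px ∷ pxs

bound-propagates : ∀ e {l l' κ κ' σ σ'} → l ≤ e + l' → κ + (e + σ') ≤ κ' + σ → l' + κ' ≤ σ' → l + κ ≤ σ
bound-propagates e {l} {l'} {κ} {κ'} {σ} {σ'} l≤e+l' potential bound' = +-cancelʳ-≤ σ' _ _ (begin
  (l + κ) + σ'             ≤⟨ +-monoˡ-≤ σ' (+-monoˡ-≤ κ l≤e+l') ⟩
  ((e + l') + κ) + σ'      ≡⟨ rearrange e l' κ σ' ⟩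
  l' + (κ + (e + σ'))      ≤⟨ +-monoʳ-≤ l' potential ⟩
  l' + (κ' + σ)            ≡⟨ sym (+-assoc l' κ' σ) ⟩
  (l' + κ') + σ            ≤⟨ +-monoˡ-≤ σ bound' ⟩
  σ' + σ                   ≡⟨ +-comm σ' σ ⟩
  σ + σ'                   ∎)
  where
  open ≤-Reasoning
  rearrange : ∀ e l' κ σ' → ((e + l') + κ) + σ' ≡ l' + (κ + (e + σ'))
  rearrange = solve-∀

module KohnertChainProperties
  (n : ℕ) (D : ℕ → Diagram) (rows : ℕ → ℕ) (chain : KohnertChain n D rows)
  (noCellInRowZero₀ : NoCellInRowZero (D 0)) (c k : ℕ) where

  open KthCellOfColumn c k

  MovesKth : ℕ → Set
  MovesKth i = KohnertStep (D i) (rows i) c (D (suc i)) × Kth (D i) (rows i)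

  MovesKthFrom : ℕ → ℕ → Set
  MovesKthFrom j i = j ≤ i × i < n × MovesKth i

  moves-bounded : ∀ {c̃} → c ≤ c̃ → ∀ m j → m + j ≡ n → ∀ {σ} → Kth (D j) σ →
                  ∀ {T} → Unique T → All (MovesKthFrom j) T → length T + count (D j) σ c̃ ≤ σ
  moves-bounded c≤c̃ zero j refl {σ} _ {[]} _ [] = count-≤ (D j) (chain-noCellInRowZero chain noCellInRowZero₀ j ≤-refl) σ
  moves-bounded c≤c̃ zero j refl _ _ ((j≤i , i<j , _) ∷ _) = contradiction j≤i (<⇒≱ i<j)
  moves-bounded {c̃} c≤c̃ (suc m) j 1+m+j≡n {σ} kth {T} uniq moves =
    let (c₀ , step) = chain j (subst (j <_) 1+m+j≡n (m<n+m j z<s))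
        (e , T-shrinks , σ' , kth' , potential) = step-lowers-potential step
    in bound-propagates e T-shrinks potential
         (moves-bounded c≤c̃ m (suc j) (trans (+-suc m j) 1+m+j≡n) kth' (Unique.filter⁺ _ uniq) later-moves)
    where
    T⁻ : List ℕ
    T⁻ = filter (λ i → ¬? (i ≟ j)) T
    later-moves : All (MovesKthFrom (suc j)) T⁻
    later-moves = All.map (λ (i≢j , j≤i , later) → ≤∧≢⇒< j≤i (i≢j ∘ sym) , later)
                          (All.zip (all-filter _ T , filter⁺ _ moves))
    step-lowers-potential : ∀ {c₀} → KohnertStep (D j) (rows j) c₀ (D (suc j)) →
      Σ ℕ λ e → length T ≤ e + length T⁻ × PotentialDrop e c̃ (D j) σ (D (suc j))
    step-lowers-potential {c₀} step with (c₀ ≟ c) ×-dec (σ ≟ rows j)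
    ... | yes (refl , refl) = 1 , length-≤-suc-filter-≢ j uniq , kth-moved c≤c̃ step kth
    ... | no not-moved = 0 , ≤-reflexive (cong length (sym (filter-all _ j∉T))) ,
                         kth-not-moved step kth not-moved
      where
      j∉T : All (_≢ j) T
      j∉T = All.map (λ { (_ , _ , step-j , kth-j) refl →
        not-moved (rightmost-unique (proj₁ step) (proj₁ step-j) , kth-unique kth kth-j) }) moves

  moved-rows-bounded : ∀ {c̃} → c ≤ c̃ → ∀ {σ} → Kth (D 0) σ → ∀ {L} → Unique L →
                       All (λ s → Σ ℕ λ i → rows i ≡ s × MovesKthFrom 0 i) L → length L + count (D 0) σ c̃ ≤ σ
  moved-rows-bounded c≤c̃ kth uniq moved with all-preimages moved
  ... | T , refl , moves = subst (λ l → l + _ ≤ _) (sym (length-map rows T))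
        (moves-bounded c≤c̃ n 0 (+-identityʳ n) kth (Unique.map⁻ uniq) moves)

≤-room : ∀ E r c {l} → (∀ c̃ → c ≤ c̃ → l + countBlockers E r c̃ ≤ r) → l ≤ room E r c
≤-room E r c {l} bound = begin
  l              ≡⟨ m∸[m∸n]≡n (m+n≤o⇒m≤o l (bound c ≤-refl)) ⟨
  r ∸ (r ∸ l)    ≤⟨ ∸-monoʳ-≤ r (foldr-preservesᵇ {P = _≤ r ∸ l} {f = _⊔_} ⊔-lub z≤n
                                  (map⁺ (All.universal blockers-bound (upTo (suc (maxCol E)))))) ⟩
  room E r c     ∎
  where
  open ≤-Reasoning
  blockers-bound : ∀ x → countBlockers E r (c + x) ≤ r ∸ l
  blockers-bound x = m+n≤o⇒m≤o∸n _ (≤-trans (≤-reflexive (+-comm _ l)) (bound (c + x) (m≤m+n c x)))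

proposition3p3 : (n : ℕ) (D : ℕ → Diagram) (rows : ℕ → ℕ) (r c : ℕ) →
    ValidDiagram (D 0) → (r , c) ∈ D 0 → KohnertChain n D rows →
    (L : List ℕ) → Unique L → All (InR n D rows r c) L →
    length L ≤ room (D 0) r c
proposition3p3 n D rows r c valid rc∈D0 chain L uniq inR = ≤-room (D 0) r c blockers-bound
  where
  open KohnertChainProperties n D rows chain (valid⇒noCellInRowZero valid) c (count (D 0) r c)
  inR⇒moves : ∀ {s} → InR n D rows r c s → Σ ℕ λ i → rows i ≡ s × MovesKthFrom 0 i
  inR⇒moves (j , j<n , refl , step , s∈Dj , same-rank) = j , refl , z≤n , j<n , step , s∈Dj ,
    trans (sym (countBlockers≡count (D j) (rows j) c)) (trans same-rank (countBlockers≡count (D 0) r c))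
  blockers-bound : ∀ c̃ → c ≤ c̃ → length L + countBlockers (D 0) r c̃ ≤ r
  blockers-bound c̃ c≤c̃ = subst (λ b → length L + b ≤ r) (sym (countBlockers≡count (D 0) r c̃))
    (moved-rows-bounded c≤c̃ (rc∈D0 , refl) uniq (All.map inR⇒moves inR))
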